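{- Let $m$ and $n$ be non-negative integers. Then the set $[1,m]^n$ of words of length $n$ with entries in $\{1,\dots,m\}$ is the disjoint union $$[1,m]^n=\bigsqcup_{0\le k\le \min(m,n)}\ \bigsqcup_{v\in RG(n,k)} [v,\omega_m(v)],$$ where $[v,\omega_m(v)]$ denotes the interval $\{w\in\mathbb{P}^n: v\le w\le \omega_m(v)\}$ in the poset $\mathbb{P}^n$.
   Context: $\mathbb{P}$ denotes the positive integers and $\mathbb{P}^n$ the set of words $w_1w_2\cdots w_n$ of length $n$ with entries in $\mathbb{P}$, partially ordered entrywise: $v_1\cdots v_n\le w_1\cdots w_n$ iff $v_i\le w_i$ for all $i$. For $S\subseteq\mathbb{P}$, $S^*$ denotes the set of all finite words (including the empty word) with entries in $S$, and $[1,i]=\{1,\dots,i\}$. A word $w=w_1\cdots w_n$ of positive integers is an $RG$-word (restricted growth word) if $w_i\le\max(0,w_1,\dots,w_{i-1})+1$ for all $i$; $RG(n,k)$ is the set of $RG$-words of length $n$ with maximal entry $k$ ($RG(0,0)$ consists of the empty word, and $RG(n,0)=\emptyset$ for $n>0$). Every $v\in RG(n,k)$ has a unique factorization $v=1\cdot u_1\cdot 2\cdot u_2\cdots k\cdot u_k$ (concatenation) with $u_i\in[1,i]^*$. For an integer $m\ge k$ define $\omega_m(v)=m\cdot u_1\cdot m\cdot u_2\cdots m\cdot u_k$, i.e. each left-to-right maximum of $v$ is replaced by $m$. -}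

module Defs where

open import Data.Nat using (ℕ; zero; suc; _≤_; _<_; _⊔_; _<ᵇ_)
open import Data.Bool using (if_then_else_)
open import Data.Product using (_×_)
open import Data.Vec using (Vec; []; _∷_)
open import Data.Vec.Relation.Unary.All using (All)
open import Data.Vec.Relation.Binary.Pointwise.Inductive using (Pointwise)

_≤ʷ_ : ∀ {n} → Vec ℕ n → Vec ℕ n → Set
_≤ʷ_ = Pointwise _≤_

InBox : ℕ → ∀ {n} → Vec ℕ n → Set
InBox m w = All (λ x → 1 ≤ x × x ≤ m) w

data RGFrom : ℕ → ∀ {n} → Vec ℕ n → ℕ → Set where
  rg-[] : ∀ {c} → RGFrom c [] c
  rg-∷  : ∀ {c x n k} {xs : Vec ℕ n} →
          1 ≤ x → x ≤ suc c → RGFrom (c ⊔ x) xs k → RGFrom c (x ∷ xs) k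

-- v ∈ RG(n,k): v is an RG-word (w_i ≤ max(0,w_1..w_{i-1})+1) with maximal entry k.
-- (RG(0,0) = {empty word}; RG(n,0) = ∅ for n > 0.)
IsRG : ∀ {n} → Vec ℕ n → ℕ → Set
IsRG v k = RGFrom 0 v k

-- ωFrom m c v : replace each left-to-right maximum (entry strictly larger than
-- the running maximum c of the earlier entries, c starting at 0) by m.
ωFrom : ℕ → ℕ → ∀ {n} → Vec ℕ n → Vec ℕ n
ωFrom m c []       = []
ωFrom m c (x ∷ xs) = if c <ᵇ x then m ∷ ωFrom m x xs else x ∷ ωFrom m c xs

ω : ℕ → ∀ {n} → Vec ℕ n → Vec ℕ n
ω m v = ωFrom m 0 v

InInterval : ℕ → ∀ {n} → Vec ℕ n → Vec ℕ n → Set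
InInterval m v w = (v ≤ʷ w) × (w ≤ʷ ω m v)

-- Read a word w ∈ [1,m]^n from left to right, keeping the running maximum c of the
-- RG-word v under construction. If w_i > c, then v_i cannot repeat an old letter
-- (ω_m(v) would keep w_i ≤ v_i ≤ c), so v_i = c + 1 is a new left-to-right maximum
-- and ω_m(v)_i = m ≥ w_i; if w_i ≤ c, then v_i cannot be the new maximum c + 1 > w_i,
-- so v_i is kept by ω_m and v_i ≤ w_i ≤ v_i forces v_i = w_i. Hence w determines v,
-- and conversely this v is an RG-word whose interval contains w.
module Submission where

open import Defs
open import Data.Nat using (ℕ; suc; _+_; _≤_; _<_; _⊓_; _<ᵇ_; z≤n; s≤s; _≤?_)
open import Data.Nat.Properties
open import Data.Bool using (true; false; if_then_else_)
open import Data.Vec using (Vec; []; _∷_)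
open import Data.Vec.Relation.Unary.All as All using (All; []; _∷_)
open import Data.Vec.Relation.Binary.Pointwise.Inductive using ([]; _∷_)
open import Data.Product using (_×_; ∃-syntax; _,_; proj₁; proj₂)
open import Relation.Nullary using (yes; no; contradiction)
open import Relation.Nullary.Reflects using (ofʸ; ofⁿ)
open import Relation.Binary.PropositionalEquality using (_≡_; refl; sym; trans; cong; subst)

<ᵇ-true : ∀ {c x} → c < x → (c <ᵇ x) ≡ true
<ᵇ-true {c} {x} c<x with c <ᵇ x | <ᵇ-reflects-< c x
... | true  | _       = refl
... | false | ofⁿ c≮x = contradiction c<x c≮x

<ᵇ-false : ∀ {c x} → x ≤ c → (c <ᵇ x) ≡ false
<ᵇ-false {c} {x} x≤c with c <ᵇ x | <ᵇ-reflects-< c x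
... | true  | ofʸ c<x = contradiction c<x (≤⇒≯ x≤c)
... | false | _       = refl

-- The factorization v = 1·u₁·2·u₂⋯k·u_k read letter by letter: each letter is either the
-- next left-to-right maximum c + 1 or a repeat from [1,c].
data RG : ℕ → ∀ {n} → Vec ℕ n → ℕ → Set where
  []   : ∀ {c} → RG c [] c
  max∷ : ∀ {c n k} {xs : Vec ℕ n} → RG (suc c) xs k → RG c (suc c ∷ xs) k
  old∷ : ∀ {c x n k} {xs : Vec ℕ n} → 1 ≤ x → x ≤ c → RG c xs k → RG c (x ∷ xs) k

RGFrom⇒RG : ∀ {c n k} {v : Vec ℕ n} → RGFrom c v k → RG c v k
RGFrom⇒RG rg-[] = []
RGFrom⇒RG {c} (rg-∷ {x = x} 1≤x x≤1+c r) with x ≤? c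
... | yes x≤c = old∷ 1≤x x≤c (RGFrom⇒RG (subst (λ d → RGFrom d _ _) (m≥n⇒m⊔n≡m x≤c) r))
... | no  x≰c with refl ← ≤-antisym x≤1+c (≰⇒> x≰c) =
  max∷ (RGFrom⇒RG (subst (λ d → RGFrom d _ _) (m≤n⇒m⊔n≡n (n≤1+n c)) r))

RG⇒RGFrom : ∀ {c n k} {v : Vec ℕ n} → RG c v k → RGFrom c v k
RG⇒RGFrom [] = rg-[]
RG⇒RGFrom {c} (max∷ r) =
  rg-∷ (s≤s z≤n) ≤-refl (subst (λ d → RGFrom d _ _) (sym (m≤n⇒m⊔n≡n (n≤1+n c))) (RG⇒RGFrom r))
RG⇒RGFrom (old∷ 1≤x x≤c r) =
  rg-∷ 1≤x (m≤n⇒m≤1+n x≤c) (subst (λ d → RGFrom d _ _) (sym (m≥n⇒m⊔n≡m x≤c)) (RG⇒RGFrom r))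

RG-start≤max : ∀ {c n k} {v : Vec ℕ n} → RG c v k → c ≤ k
RG-start≤max []           = ≤-refl
RG-start≤max (max∷ r)     = <⇒≤ (RG-start≤max r)
RG-start≤max (old∷ _ _ r) = RG-start≤max r

RG-max≤start+length : ∀ {c n k} {v : Vec ℕ n} → RG c v k → k ≤ c + n
RG-max≤start+length {c} [] = ≤-reflexive (sym (+-identityʳ c))
RG-max≤start+length {c} {suc n} (max∷ r) = ≤-trans (RG-max≤start+length r) (≤-reflexive (sym (+-suc c n)))
RG-max≤start+length {c} {suc n} (old∷ _ _ r) = ≤-trans (RG-max≤start+length r) (+-monoʳ-≤ c (n≤1+n n))

RG-max≤ : ∀ {c m n k} {v : Vec ℕ n} → RG c v k → c ≤ m → All (_≤ m) v → k ≤ m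
RG-max≤ []           c≤m []             = c≤m
RG-max≤ (max∷ r)     _   (1+c≤m ∷ v≤m)  = RG-max≤ r 1+c≤m v≤m
RG-max≤ (old∷ _ _ r) c≤m (_ ∷ v≤m)      = RG-max≤ r c≤m v≤m

RG-functional : ∀ {c n k k′} {v : Vec ℕ n} → RG c v k → RG c v k′ → k ≡ k′
RG-functional [] [] = refl
RG-functional (max∷ r) (max∷ r′) = RG-functional r r′
RG-functional (max∷ _) (old∷ _ 1+c≤c _) = contradiction 1+c≤c (n≮n _)
RG-functional (old∷ _ 1+c≤c _) (max∷ _) = contradiction 1+c≤c (n≮n _)
RG-functional (old∷ _ _ r) (old∷ _ _ r′) = RG-functional r r′

RG-positive : ∀ {c n k} {v : Vec ℕ n} → RG c v k → All (1 ≤_) v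
RG-positive []             = []
RG-positive (max∷ r)       = s≤s z≤n ∷ RG-positive r
RG-positive (old∷ 1≤x _ r) = 1≤x ∷ RG-positive r

ωFrom-max : ∀ m c {n} (xs : Vec ℕ n) → ωFrom m c (suc c ∷ xs) ≡ m ∷ ωFrom m (suc c) xs
ωFrom-max m c xs rewrite <ᵇ-true (n<1+n c) = refl

ωFrom-old : ∀ m {c x n} (xs : Vec ℕ n) → x ≤ c → ωFrom m c (x ∷ xs) ≡ x ∷ ωFrom m c xs
ωFrom-old m xs x≤c rewrite <ᵇ-false x≤c = refl

ωFrom-bounded : ∀ {m c n k} {v : Vec ℕ n} → RG c v k → k ≤ m → All (_≤ m) (ωFrom m c v)
ωFrom-bounded [] _ = []
ωFrom-bounded {m} {c} (max∷ {xs = xs} r) k≤m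
  rewrite ωFrom-max m c xs = ≤-refl ∷ ωFrom-bounded r k≤m
ωFrom-bounded {m} (old∷ {xs = xs} _ x≤c r) k≤m
  rewrite ωFrom-old m xs x≤c = ≤-trans x≤c (≤-trans (RG-start≤max r) k≤m) ∷ ωFrom-bounded r k≤m

InIntervalFrom : ℕ → ℕ → ∀ {n} → Vec ℕ n → Vec ℕ n → Set
InIntervalFrom m c v w = (v ≤ʷ w) × (w ≤ʷ ωFrom m c v)

All≥-upward : ∀ {a n} {v w : Vec ℕ n} → v ≤ʷ w → All (a ≤_) v → All (a ≤_) w
All≥-upward []           []         = []
All≥-upward (x≤y ∷ v≤w) (a≤x ∷ a≤v) = ≤-trans a≤x x≤y ∷ All≥-upward v≤w a≤v

All≤-downward : ∀ {a n} {v w : Vec ℕ n} → v ≤ʷ w → All (_≤ a) w → All (_≤ a) v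
All≤-downward []           []         = []
All≤-downward (x≤y ∷ v≤w) (y≤a ∷ w≤a) = ≤-trans x≤y y≤a ∷ All≤-downward v≤w w≤a

interval⊆box : ∀ {m c n k} {v w : Vec ℕ n} → RG c v k → k ≤ m → InIntervalFrom m c v w → InBox m w
interval⊆box r k≤m (v≤w , w≤ωv) =
  All.zip (All≥-upward v≤w (RG-positive r) , All≤-downward w≤ωv (ωFrom-bounded r k≤m))

rgBase : ℕ → ∀ {n} → Vec ℕ n → Vec ℕ n
rgBase c []       = []
rgBase c (y ∷ ys) = if c <ᵇ y then suc c ∷ rgBase (suc c) ys else y ∷ rgBase c ys

rgBase-RG : ∀ {c n} {w : Vec ℕ n} → All (1 ≤_) w → ∃[ k ] RG c (rgBase c w) k
rgBase-RG [] = _ , []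
rgBase-RG {c} {w = y ∷ _} (1≤y ∷ 1≤w) with c <ᵇ y | <ᵇ-reflects-< c y
... | true  | _       = let k , r = rgBase-RG 1≤w in k , max∷ r
... | false | ofⁿ c≮y = let k , r = rgBase-RG 1≤w in k , old∷ 1≤y (≮⇒≥ c≮y) r

rgBase-≤ʷ : ∀ {c n} (w : Vec ℕ n) → rgBase c w ≤ʷ w
rgBase-≤ʷ [] = []
rgBase-≤ʷ {c} (y ∷ ys) with c <ᵇ y | <ᵇ-reflects-< c y
... | true  | ofʸ c<y = c<y ∷ rgBase-≤ʷ ys
... | false | _       = ≤-refl ∷ rgBase-≤ʷ ys

≤ʷ-ωFrom-rgBase : ∀ {m c n} {w : Vec ℕ n} → All (_≤ m) w → w ≤ʷ ωFrom m c (rgBase c w)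
≤ʷ-ωFrom-rgBase [] = []
≤ʷ-ωFrom-rgBase {m} {c} {w = y ∷ ys} (y≤m ∷ w≤m) with c <ᵇ y | <ᵇ-reflects-< c y
... | true  | _       rewrite ωFrom-max m c (rgBase (suc c) ys) = y≤m ∷ ≤ʷ-ωFrom-rgBase w≤m
... | false | ofⁿ c≮y rewrite ωFrom-old m (rgBase c ys) (≮⇒≥ c≮y) = ≤-refl ∷ ≤ʷ-ωFrom-rgBase w≤m

rgBase-unique : ∀ {m c n k} {v w : Vec ℕ n} → RG c v k → InIntervalFrom m c v w → v ≡ rgBase c w
rgBase-unique [] ([] , []) = refl
rgBase-unique {m} {c} (max∷ {xs = xs} r) (1+c≤y ∷ v≤w , w≤ωv)
  with subst (_ ≤ʷ_) (ωFrom-max m c xs) w≤ωv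
... | _ ∷ w≤ωxs rewrite <ᵇ-true 1+c≤y = cong (suc c ∷_) (rgBase-unique r (v≤w , w≤ωxs))
rgBase-unique {m} (old∷ {x = x} {xs = xs} _ x≤c r) (x≤y ∷ v≤w , w≤ωv)
  with subst (_ ≤ʷ_) (ωFrom-old m xs x≤c) w≤ωv
... | y≤x ∷ w≤ωxs with refl ← ≤-antisym y≤x x≤y rewrite <ᵇ-false x≤c =
  cong (x ∷_) (rgBase-unique r (v≤w , w≤ωxs))

box⊆interval : ∀ {m c n} {w : Vec ℕ n} → c ≤ m → InBox m w →
               ∃[ k ] k ≤ m × RG c (rgBase c w) k × InIntervalFrom m c (rgBase c w) w
box⊆interval {w = w} c≤m w∈box with k , r ← rgBase-RG (All.map proj₁ w∈box) =
  k , RG-max≤ r c≤m (All≤-downward (rgBase-≤ʷ w) w≤m) , r , rgBase-≤ʷ w , ≤ʷ-ωFrom-rgBase w≤m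
  where w≤m = All.map proj₂ w∈box

intervals-disjoint : ∀ {m c n k k′} {v v′ w : Vec ℕ n} →
                     RG c v k → InIntervalFrom m c v w → RG c v′ k′ → InIntervalFrom m c v′ w →
                     k ≡ k′ × v ≡ v′
intervals-disjoint r w∈[v] r′ w∈[v′]
  with refl ← trans (rgBase-unique r w∈[v]) (sym (rgBase-unique r′ w∈[v′])) = RG-functional r r′ , refl

theorem5p1 : (m n : ℕ) →
    -- every block of the union lies in [1,m]^n
    ((k : ℕ) (v w : Vec ℕ n) → k ≤ m ⊓ n → IsRG v k → InInterval m v w → InBox m w)
    ×
    -- every element of [1,m]^n lies in some block
    ((w : Vec ℕ n) → InBox m w →
      ∃[ k ] ∃[ v ] (k ≤ m ⊓ n × IsRG v k × InInterval m v w))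
    ×
    -- the blocks are pairwise disjoint
    ((k k′ : ℕ) (v v′ w : Vec ℕ n) →
      k ≤ m ⊓ n → IsRG v k → InInterval m v w →
      k′ ≤ m ⊓ n → IsRG v′ k′ → InInterval m v′ w →
      (k ≡ k′ × v ≡ v′))
theorem5p1 m n =
  (λ k v w k≤m⊓n r → interval⊆box (RGFrom⇒RG r) (≤-trans k≤m⊓n (m⊓n≤m m n))) ,
  (λ w w∈box → let k , k≤m , r , w∈[v] = box⊆interval z≤n w∈box in
     k , rgBase 0 w , ⊓-glb k≤m (RG-max≤start+length r) , RG⇒RGFrom r , w∈[v]) ,
  (λ _ _ _ _ _ _ r w∈[v] _ r′ w∈[v′] →
     intervals-disjoint (RGFrom⇒RG r) w∈[v] (RGFrom⇒RG r′) w∈[v′])
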